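{- Let $C=(V,E;w)$ be a cycle graph with positive edge weights $w$ and total weight $\sum_{e\in E}w(e)=c$, and let $d_C$ be its shortest path metric. Let $x,y,z\in V$ be three distinct vertices with $d_C(x,y)+d_C(y,z)+d_C(z,x)=c$. Then there exists $p^*\in V$ with $d_C(x,p^*)+d_C(y,p^*)+d_C(z,p^*)=\tfrac12\{d_C(x,y)+d_C(y,z)+d_C(z,x)\}$ if and only if $\max\{d_C(x,y),d_C(y,z),d_C(z,x)\}=c/2$.
   Formalization: The edge weights $w$ are positive rationals rather than positive reals. -}

module Defs where

open import Data.Nat as ℕ using (ℕ; zero; suc)
open import Data.Fin using (Fin; toℕ; fromℕ<)
import Data.Fin as Fin
open import Data.List using (List; foldr; map)
open import Data.List using () renaming ([] to nil)
open import Data.Fin.Base using ()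
open import Data.List.Base using ()
open import Data.Rational using (ℚ; 0ℚ; _+_; _⊓_)
open import Relation.Nullary using (yes; no)

-- Cycle graph C_n on vertex set Fin n (n ≥ 3): edge number i joins vertex i
-- and vertex (i+1 mod n).  A weighting assigns the weight  w i  to edge i.

next : ∀ {n} → Fin n → Fin n
next {suc m} i with suc (toℕ i) ℕ.<? suc m
... | yes p = fromℕ< p
... | no _  = Fin.zero

arc : ∀ {n} → (Fin n → ℚ) → Fin n → ℕ → ℚ
arc w i zero    = 0ℚ
arc w i (suc k) = w i + arc w (next i) k

steps : ∀ {n} → Fin n → Fin n → ℕ
steps {n} i j with toℕ i ℕ.≤? toℕ j
... | yes _ = toℕ j ℕ.∸ toℕ i
... | no _  = (n ℕ.∸ toℕ i) ℕ.+ toℕ j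

forwardLen : ∀ {n} → (Fin n → ℚ) → Fin n → Fin n → ℚ
forwardLen w i j = arc w i (steps i j)

-- shortest path metric of the weighted cycle: in a cycle the only paths
-- (simple) between i and j are the forward path i→j and the forward path j→i
-- (traversed backwards); d_C is the smaller of the two weights.
dist : ∀ {n} → (Fin n → ℚ) → Fin n → Fin n → ℚ
dist w i j = forwardLen w i j ⊓ forwardLen w j i

totalWeight : ∀ {n} → (Fin n → ℚ) → ℚ
totalWeight {n} w = foldr _+_ 0ℚ (map w (Data.List.allFin n))
  where import Data.List

-- Going around the cycle, three distinct vertices x, y, z cut it into three
-- consecutive arcs, of lengths a, b, c with a + b + c = T (the total weight),
-- taken in one of the two orientations.  Since every distance is at most the
-- arc realising it, the hypothesis d(x,y) + d(y,z) + d(z,x) = T forces the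
-- three distances to be exactly a, b, c, so each is at most T/2.
-- A point p lies on one of the three arcs, say at distances u from x and v
-- from y on the arc xy (u + v = a).  Then d(x,p) + d(y,p) = a, and d(z,p) is
-- either c + u or b + v.  A distance sum of T/2 then gives b = T/2 + u or
-- c = T/2 + v, so b or c equals T/2.  Conversely, if d(x,y) = T/2 then
-- p = z has distance sum d(y,z) + d(z,x) = T - T/2.
module Submission where

open import Algebra.Bundles using (CommutativeMonoid)
import Algebra.Properties.CommutativeSemigroup as CommutativeSemigroupProperties
open import Data.Empty using (⊥-elim)
open import Data.Fin as Fin using (Fin; toℕ)
import Data.Fin.Properties as Finₚ
open import Data.List using (foldr; map; tabulate)
open import Data.Nat as ℕ using (ℕ; zero; suc)
open import Data.Nat.DivMod using (_mod_; [m+n]%n≡m%n; m<n⇒m%n≡m)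
import Data.Nat.Properties as ℕₚ
open import Data.Product using (_,_; ∃-syntax)
open import Data.Rational using (ℚ; 0ℚ; ½; _+_; _-_; -_; _*_; _<_; _⊓_; _⊔_)
open import Data.Rational.Properties
import Data.Rational.Solver as ℚ-Solver
open import Data.Sum using (_⊎_; inj₁; inj₂)
open import Function using (_∘_; id)
open import Function.Bundles using (_⇔_; mk⇔)
open import Function.Construct.Composition using (_⇔-∘_)
open import Relation.Binary.Definitions using (DecidableEquality)
open import Relation.Binary.PropositionalEquality
open import Relation.Nullary using (yes; no; contradiction)

open import Defs

module +-Semigroup =
  CommutativeSemigroupProperties (CommutativeMonoid.commutativeSemigroup +-0-commutativeMonoid)

module RationalArithmetic where

  open import Data.Rational using (_≤_)
  open ℚ-Solver.+-*-Solver using (solve; _:=_; _:+_; _:-_; :-_; _:*_; con)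

  p≤p+q : ∀ p {q} → 0ℚ ≤ q → p ≤ p + q
  p≤p+q p {q} 0≤q = subst (_≤ p + q) (+-identityʳ p) (+-monoʳ-≤ p 0≤q)

  p≤q+p : ∀ p {q} → 0ℚ ≤ q → p ≤ q + p
  p≤q+p p {q} 0≤q = subst (p ≤_) (+-comm p q) (p≤p+q p 0≤q)

  p<p+q : ∀ p {q} → 0ℚ < q → p < p + q
  p<p+q p {q} 0<q = subst (_< p + q) (+-identityʳ p) (+-monoʳ-< p 0<q)

  p+q≡r⇒q≡r-p : ∀ {p q r} → p + q ≡ r → q ≡ r - p
  p+q≡r⇒q≡r-p {p} {q} refl = q≡[p+q]-p p q
    where
    q≡[p+q]-p : ∀ p q → q ≡ (p + q) - p
    q≡[p+q]-p = solve 2 (λ p q → q := (p :+ q) :- p) refl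

  p+q≡r⇒p≡r-q : ∀ {p q r} → p + q ≡ r → p ≡ r - q
  p+q≡r⇒p≡r-q {p} {q} e = p+q≡r⇒q≡r-p (trans (+-comm q p) e)

  +-cancelˡ-≤ : ∀ r {p q} → r + p ≤ r + q → p ≤ q
  +-cancelˡ-≤ r {p} {q} r+p≤r+q =
    subst₂ _≤_ (-r+[r+p]≡p r p) (-r+[r+p]≡p r q) (+-monoʳ-≤ (- r) r+p≤r+q)
    where
    -r+[r+p]≡p : ∀ r p → - r + (r + p) ≡ p
    -r+[r+p]≡p = solve 2 (λ r p → :- r :+ (r :+ p) := p) refl

  +-tightʳ : ∀ {p p′ q q′} → p ≤ p′ → q ≤ q′ → p + q ≡ p′ + q′ → q ≡ q′
  +-tightʳ {p} {p′} {q} {q′} p≤p′ q≤q′ e =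
    ≤-antisym q≤q′ (+-cancelˡ-≤ p (≤-trans (+-monoˡ-≤ q′ p≤p′) (≤-reflexive (sym e))))

  rotate₃ : ∀ {p q r s} → (p + q) + r ≡ s → (q + r) + p ≡ s
  rotate₃ {p} {q} {r} = trans (sym (+-Semigroup.xy∙z≈yz∙x p q r))

  swap₃ : ∀ {p q r s} → (p + q) + r ≡ s → (p + r) + q ≡ s
  swap₃ {p} {q} {r} = trans (sym (+-Semigroup.xy∙z≈xz∙y p q r))

  r-½r≡½r : ∀ r → r - ½ * r ≡ ½ * r
  r-½r≡½r = solve 1 (λ r → r :- con ½ :* r := con ½ :* r) refl

  half≤complement : ∀ {p q r} → p + q ≡ r → p ≤ ½ * r → ½ * r ≤ q
  half≤complement {p} {q} {r} e p≤½r = begin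
    ½ * r      ≡⟨ r-½r≡½r r ⟨
    r - ½ * r  ≤⟨ +-monoʳ-≤ r (neg-antimono-≤ p≤½r) ⟩
    r - p      ≡⟨ p+q≡r⇒q≡r-p e ⟨
    q          ∎
    where open ≤-Reasoning

  half-complement : ∀ {p q r} → p + q ≡ r → p ≡ ½ * r → q ≡ ½ * r
  half-complement {r = r} e refl = trans (p+q≡r⇒q≡r-p e) (r-½r≡½r r)

  p⊓q≤½[p+q] : ∀ p q → p ⊓ q ≤ ½ * (p + q)
  p⊓q≤½[p+q] p q = subst (_≤ ½ * (p + q)) (½[r+r]≡r (p ⊓ q))
    (*-monoˡ-≤-nonNeg ½ (+-mono-≤ (p⊓q≤p p q) (p⊓q≤q p q)))
    where
    ½[r+r]≡r : ∀ r → ½ * (r + r) ≡ r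
    ½[r+r]≡r = solve 1 (λ r → con ½ :* (r :+ r) := r) refl

  ⊔₃≡⇔ : ∀ {p q r s} → p ≤ s → q ≤ s → r ≤ s →
         (p ≡ s ⊎ q ≡ s ⊎ r ≡ s) ⇔ ((p ⊔ q) ⊔ r ≡ s)
  ⊔₃≡⇔ {p} {q} {r} {s} p≤s q≤s r≤s = mk⇔ attained selected
    where
    attained : p ≡ s ⊎ q ≡ s ⊎ r ≡ s → (p ⊔ q) ⊔ r ≡ s
    attained (inj₁ refl)        = trans (cong (_⊔ r) (p≥q⇒p⊔q≡p q≤s)) (p≥q⇒p⊔q≡p r≤s)
    attained (inj₂ (inj₁ refl)) = trans (cong (_⊔ r) (p≤q⇒p⊔q≡q p≤s)) (p≥q⇒p⊔q≡p r≤s)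
    attained (inj₂ (inj₂ refl)) = p≤q⇒p⊔q≡q (⊔-lub p≤s q≤s)
    selected : (p ⊔ q) ⊔ r ≡ s → p ≡ s ⊎ q ≡ s ⊎ r ≡ s
    selected e with ⊔-sel (p ⊔ q) r | ⊔-sel p q
    ... | inj₂ ≡r  | _       = inj₂ (inj₂ (trans (sym ≡r) e))
    ... | inj₁ ≡pq | inj₁ ≡p = inj₁ (trans (sym ≡p) (trans (sym ≡pq) e))
    ... | inj₁ ≡pq | inj₂ ≡q = inj₂ (inj₁ (trans (sym ≡q) (trans (sym ≡pq) e)))

-- fwd i j is the length of the arc from i to j in the positive direction on a
-- circle of circumference T, and d is the induced shortest-path metric.
module Circle {V : Set} (_≟_ : DecidableEquality V) (T : ℚ) (fwd : V → V → ℚ)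
  (fwd-refl : ∀ i → fwd i i ≡ 0ℚ)
  (fwd-pos : ∀ {i j} → i ≢ j → 0ℚ < fwd i j)
  (fwd-concat : ∀ i j k → fwd i j + fwd j k ≡ fwd i k ⊎ fwd i j + fwd j k ≡ fwd i k + T)
  where

  open import Data.Rational using (_≤_)
  open RationalArithmetic
  open ℚ-Solver.+-*-Solver using (solve; _:=_; _:+_; _:-_)

  d : V → V → ℚ
  d i j = fwd i j ⊓ fwd j i

  d-sym : ∀ i j → d i j ≡ d j i
  d-sym i j = ⊓-comm (fwd i j) (fwd j i)

  d-refl : ∀ i → d i i ≡ 0ℚ
  d-refl i = trans (⊓-idem (fwd i i)) (fwd-refl i)

  fwd-nonneg : ∀ i j → 0ℚ ≤ fwd i j
  fwd-nonneg i j with i ≟ j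
  ... | yes refl = ≤-reflexive (sym (fwd-refl i))
  ... | no i≢j   = <⇒≤ (fwd-pos i≢j)

  fwd-round-trip-pos : ∀ {i j} → i ≢ j → 0ℚ < fwd i j + fwd j i
  fwd-round-trip-pos i≢j = +-mono-< (fwd-pos i≢j) (fwd-pos (i≢j ∘ sym))

  fwd-round-trip : ∀ {i j} → i ≢ j → fwd i j + fwd j i ≡ T
  fwd-round-trip {i} {j} i≢j with fwd-concat i j i
  ... | inj₁ e = ⊥-elim (<-irrefl (sym (trans e (fwd-refl i))) (fwd-round-trip-pos i≢j))
  ... | inj₂ e = trans e (trans (cong (_+ T) (fwd-refl i)) (+-identityˡ T))

  fwd-reverse : ∀ {i j} → i ≢ j → fwd j i ≡ T - fwd i j
  fwd-reverse i≢j = p+q≡r⇒q≡r-p (fwd-round-trip i≢j)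

  circumference-pos : ∀ {i j} → i ≢ j → 0ℚ < T
  circumference-pos i≢j = subst (0ℚ <_) (fwd-round-trip i≢j) (fwd-round-trip-pos i≢j)

  fwd-round-trip≤ : 0ℚ ≤ T → ∀ i j → fwd i j + fwd j i ≤ T
  fwd-round-trip≤ 0≤T i j with i ≟ j
  ... | yes refl = subst (_≤ T) (sym (cong₂ _+_ (fwd-refl i) (fwd-refl i))) 0≤T
  ... | no i≢j   = ≤-reflexive (fwd-round-trip i≢j)

  fwd-concat-short : ∀ {i j k} → fwd i j + fwd j k < T → fwd i j + fwd j k ≡ fwd i k
  fwd-concat-short {i} {j} {k} short with fwd-concat i j k
  ... | inj₁ e = e
  ... | inj₂ e = ⊥-elim (<-irrefl refl
                   (≤-<-trans (p≤q+p T (fwd-nonneg i k)) (subst (_< T) e short)))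

  d≤half : ∀ {i j} → i ≢ j → d i j ≤ ½ * T
  d≤half {i} {j} i≢j =
    subst (λ t → d i j ≤ ½ * t) (fwd-round-trip i≢j) (p⊓q≤½[p+q] (fwd i j) (fwd j i))

  d≡fwd : ∀ {i j} → fwd i j ≤ ½ * T → d i j ≡ fwd i j
  d≡fwd {i} {j} short with i ≟ j
  ... | yes refl = ⊓-idem (fwd i i)
  ... | no i≢j   = p≤q⇒p⊓q≡p (≤-trans short (half≤complement (fwd-round-trip i≢j) short))

  Oriented : V → V → V → Set
  Oriented x y z = (fwd x y + fwd y z) + fwd z x ≡ T

  Between : V → V → V → Set
  Between i p j = fwd i p + fwd p j ≡ fwd i j

  perimeter : V → V → V → ℚ
  perimeter x y z = (d x y + d y z) + d z x

  distSum : V → V → V → V → ℚ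
  distSum x y z p = (d x p + d y p) + d z p

  Diametral : V → V → V → Set
  Diametral x y z = d x y ≡ ½ * T ⊎ d y z ≡ ½ * T ⊎ d z x ≡ ½ * T

  Oriented-rotate : ∀ {x y z} → Oriented x y z → Oriented y z x
  Oriented-rotate {x} {y} {z} = rotate₃ {fwd x y} {fwd y z} {fwd z x}

  perimeter-rotate : ∀ {x y z} → perimeter x y z ≡ T → perimeter y z x ≡ T
  perimeter-rotate {x} {y} {z} = rotate₃ {d x y} {d y z} {d z x}

  distSum-rotate : ∀ {x y z p s} → distSum x y z p ≡ s → distSum y z x p ≡ s
  distSum-rotate {x} {y} {z} {p} = rotate₃ {d x p} {d y p} {d z p}

  Diametral-rotate : ∀ {x y z} → Diametral y z x → Diametral x y z
  Diametral-rotate (inj₁ e)        = inj₂ (inj₁ e)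
  Diametral-rotate (inj₂ (inj₁ e)) = inj₂ (inj₂ e)
  Diametral-rotate (inj₂ (inj₂ e)) = inj₁ e

  Diametral-reflect : ∀ {x y z} → Diametral x z y → Diametral x y z
  Diametral-reflect {x} {y} {z} (inj₁ e)        = inj₂ (inj₂ (trans (d-sym z x) e))
  Diametral-reflect {x} {y} {z} (inj₂ (inj₁ e)) = inj₂ (inj₁ (trans (d-sym y z) e))
  Diametral-reflect {x} {y} {z} (inj₂ (inj₂ e)) = inj₁ (trans (d-sym x y) e)

  orientation : ∀ {x y z} → x ≢ y → y ≢ z → z ≢ x → Oriented x y z ⊎ Oriented x z y
  orientation {x} {y} {z} x≢y y≢z z≢x with fwd-concat x y z
  ... | inj₁ e = inj₁ (trans (cong (_+ fwd z x) e) (fwd-round-trip (z≢x ∘ sym)))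
  ... | inj₂ e = inj₂ (begin
    (fwd x z + fwd z y) + fwd y x
      ≡⟨ cong₂ (λ p q → (p + q) + fwd y x)
               (p+q≡r⇒p≡r-q {fwd x z} {T} (sym e)) (fwd-reverse y≢z) ⟩
    ((fwd x y + fwd y z - T) + (T - fwd y z)) + fwd y x
      ≡⟨ cong ((fwd x y + fwd y z - T) + (T - fwd y z) +_) (fwd-reverse x≢y) ⟩
    ((fwd x y + fwd y z - T) + (T - fwd y z)) + (T - fwd x y)
      ≡⟨ telescope (fwd x y) (fwd y z) T ⟩
    T ∎)
    where
    open ≡-Reasoning
    telescope : ∀ a b t → ((a + b - t) + (t - b)) + (t - a) ≡ t
    telescope = solve 3 (λ a b t → ((a :+ b :- t) :+ (t :- b)) :+ (t :- a) := t) refl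

  tight-side : ∀ {x y z} → Oriented x y z → perimeter x y z ≡ T → d z x ≡ fwd z x
  tight-side {x} {y} {z} oriented tight =
    +-tightʳ (+-mono-≤ (p⊓q≤p (fwd x y) (fwd y x)) (p⊓q≤p (fwd y z) (fwd z y)))
             (p⊓q≤p (fwd z x) (fwd x z)) (trans tight (sym oriented))

  -- If p lay on none of the three arcs, the three round trips i → p → i
  -- (each of length at most T) would add up to a + b + c + 3T = 4T.
  between-some-side : ∀ {x y z} → x ≢ y → Oriented x y z →
                      ∀ p → Between x p y ⊎ Between y p z ⊎ Between z p x
  between-some-side {x} {y} {z} x≢y oriented p
    with fwd-concat x p y | fwd-concat y p z | fwd-concat z p x
  ... | inj₁ b  | _       | _       = inj₁ b
  ... | inj₂ _  | inj₁ b  | _       = inj₂ (inj₁ b)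
  ... | inj₂ _  | inj₂ _  | inj₁ b  = inj₂ (inj₂ b)
  ... | inj₂ e₁ | inj₂ e₂ | inj₂ e₃ = ⊥-elim (<-irrefl refl (<-≤-trans 3T<4T 4T≤3T))
    where
    0<T : 0ℚ < T
    0<T = circumference-pos x≢y
    3T : ℚ
    3T = (T + T) + T
    3T<4T : 3T < 3T + T
    3T<4T = p<p+q 3T 0<T
    regroup : ∀ α β γ δ ε ζ →
              ((α + β) + (γ + δ)) + (ε + ζ) ≡ ((α + ζ) + (γ + β)) + (ε + δ)
    regroup = solve 6 (λ α β γ δ ε ζ → ((α :+ β) :+ (γ :+ δ)) :+ (ε :+ ζ)
                                      := ((α :+ ζ) :+ (γ :+ β)) :+ (ε :+ δ)) refl
    collect : ∀ a b c t → ((a + t) + (b + t)) + (c + t) ≡ ((t + t) + t) + ((a + b) + c)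
    collect = solve 4 (λ a b c t → ((a :+ t) :+ (b :+ t)) :+ (c :+ t)
                                  := ((t :+ t) :+ t) :+ ((a :+ b) :+ c)) refl
    round-trip : ∀ i → fwd i p + fwd p i ≤ T
    round-trip i = fwd-round-trip≤ (<⇒≤ 0<T) i p
    4T≤3T : 3T + T ≤ 3T
    4T≤3T = begin
      3T + T
        ≡⟨ cong (3T +_) oriented ⟨
      3T + ((fwd x y + fwd y z) + fwd z x)
        ≡⟨ collect (fwd x y) (fwd y z) (fwd z x) T ⟨
      ((fwd x y + T) + (fwd y z + T)) + (fwd z x + T)
        ≡⟨ cong₂ _+_ (cong₂ _+_ e₁ e₂) e₃ ⟨
      ((fwd x p + fwd p y) + (fwd y p + fwd p z)) + (fwd z p + fwd p x)
        ≡⟨ regroup (fwd x p) (fwd p y) (fwd y p) (fwd p z) (fwd z p) (fwd p x) ⟩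
      ((fwd x p + fwd p x) + (fwd y p + fwd p y)) + (fwd z p + fwd p z)
        ≤⟨ +-mono-≤ (+-mono-≤ (round-trip x) (round-trip y)) (round-trip z) ⟩
      3T ∎
      where open ≤-Reasoning

  antipodal-if-between : ∀ {x y z p} → x ≢ y → y ≢ z → z ≢ x →
                         Oriented x y z → perimeter x y z ≡ T → Between x p y →
                         distSum x y z p ≡ ½ * T → d y z ≡ ½ * T ⊎ d z x ≡ ½ * T
  antipodal-if-between {x} {y} {z} {p} x≢y y≢z z≢x oriented tight p∈xy median =
    conclude (⊓-sel (fwd z p) (fwd p z))
    where
    a b c u v : ℚ
    a = fwd x y
    b = fwd y z
    c = fwd z x
    u = fwd x p
    v = fwd p y
    a≤½T : a ≤ ½ * T
    a≤½T = subst (_≤ ½ * T) (tight-side (Oriented-rotate oriented) (perimeter-rotate tight))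
                 (d≤half x≢y)
    dyz≡b : d y z ≡ b
    dyz≡b = tight-side (Oriented-rotate (Oriented-rotate oriented))
                       (perimeter-rotate (perimeter-rotate tight))
    dzx≡c : d z x ≡ c
    dzx≡c = tight-side oriented tight
    u≤a : u ≤ a
    u≤a = subst (u ≤_) p∈xy (p≤p+q u (fwd-nonneg p y))
    v≤a : v ≤ a
    v≤a = subst (v ≤_) p∈xy (p≤q+p v (fwd-nonneg x p))
    a+dzp≡½T : a + d z p ≡ ½ * T
    a+dzp≡½T = begin
      a + d z p                ≡⟨ cong (_+ d z p) p∈xy ⟨
      (u + v) + d z p          ≡⟨ cong (λ q → (q + v) + d z p) (d≡fwd (≤-trans u≤a a≤½T)) ⟨
      (d x p + v) + d z p      ≡⟨ cong (λ q → (d x p + q) + d z p) (d≡fwd (≤-trans v≤a a≤½T)) ⟨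
      (d x p + d p y) + d z p  ≡⟨ cong (λ q → (d x p + q) + d z p) (d-sym p y) ⟩
      distSum x y z p          ≡⟨ median ⟩
      ½ * T                    ∎
      where open ≡-Reasoning
    conclude : d z p ≡ fwd z p ⊎ d z p ≡ fwd p z → d y z ≡ ½ * T ⊎ d z x ≡ ½ * T
    conclude (inj₁ dzp≡fzp) =
      inj₁ (trans dyz≡b
        (≤-antisym b≤½T (half≤complement (swap₃ {a} {b} {c} oriented) a+c≤½T)))
      where
      c+a<T : c + a < T
      c+a<T = subst (c + a <_) (Oriented-rotate (Oriented-rotate oriented))
                    (p<p+q (c + a) (fwd-pos y≢z))
      dzp≡c+u : d z p ≡ c + u
      dzp≡c+u = trans dzp≡fzp (sym (fwd-concat-short (≤-<-trans (+-monoʳ-≤ c u≤a) c+a<T)))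
      a+c≤½T : a + c ≤ ½ * T
      a+c≤½T = ≤-trans (+-monoʳ-≤ a (p≤p+q c (fwd-nonneg x p)))
                       (≤-reflexive (trans (cong (a +_) (sym dzp≡c+u)) a+dzp≡½T))
      b≤½T : b ≤ ½ * T
      b≤½T = subst (_≤ ½ * T) dyz≡b (d≤half y≢z)
    conclude (inj₂ dzp≡fpz) =
      inj₂ (trans dzx≡c (≤-antisym c≤½T (half≤complement oriented a+b≤½T)))
      where
      a+b<T : a + b < T
      a+b<T = subst (a + b <_) oriented (p<p+q (a + b) (fwd-pos z≢x))
      dzp≡v+b : d z p ≡ v + b
      dzp≡v+b = trans dzp≡fpz (sym (fwd-concat-short (≤-<-trans (+-monoˡ-≤ b v≤a) a+b<T)))
      a+b≤½T : a + b ≤ ½ * T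
      a+b≤½T = ≤-trans (+-monoʳ-≤ a (p≤q+p b (fwd-nonneg p y)))
                       (≤-reflexive (trans (cong (a +_) (sym dzp≡v+b)) a+dzp≡½T))
      c≤½T : c ≤ ½ * T
      c≤½T = subst (_≤ ½ * T) dzx≡c (d≤half z≢x)

  median⇒diametral-oriented : ∀ {x y z p} → x ≢ y → y ≢ z → z ≢ x →
                              Oriented x y z → perimeter x y z ≡ T →
                              distSum x y z p ≡ ½ * T → Diametral x y z
  median⇒diametral-oriented {x} {y} {z} {p} x≢y y≢z z≢x oriented tight median
    with between-some-side x≢y oriented p
  ... | inj₁ p∈xy = inj₂ (antipodal-if-between x≢y y≢z z≢x oriented tight p∈xy median)
  ... | inj₂ (inj₁ p∈yz) = Diametral-rotate (inj₂
        (antipodal-if-between y≢z z≢x x≢y (Oriented-rotate oriented) (perimeter-rotate tight)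
                              p∈yz (distSum-rotate median)))
  ... | inj₂ (inj₂ p∈zx) = Diametral-rotate (Diametral-rotate (inj₂
        (antipodal-if-between z≢x x≢y y≢z (Oriented-rotate (Oriented-rotate oriented))
                              (perimeter-rotate (perimeter-rotate tight))
                              p∈zx (distSum-rotate (distSum-rotate median)))))

  median⇒diametral : ∀ {x y z p} → x ≢ y → y ≢ z → z ≢ x →
                     perimeter x y z ≡ T → distSum x y z p ≡ ½ * T → Diametral x y z
  median⇒diametral {x} {y} {z} {p} x≢y y≢z z≢x tight median with orientation x≢y y≢z z≢x
  ... | inj₁ oriented = median⇒diametral-oriented x≢y y≢z z≢x oriented tight median
  ... | inj₂ oriented = Diametral-reflect
        (median⇒diametral-oriented (z≢x ∘ sym) (y≢z ∘ sym) (x≢y ∘ sym) oriented tight′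
                                   (swap₃ {d x p} {d y p} {d z p} median))
    where
    tight′ : perimeter x z y ≡ T
    tight′ = trans (cong₂ _+_ (cong₂ _+_ (d-sym x z) (d-sym z y)) (d-sym y x))
                   (rotate₃ {d x y} {d z x} {d y z} (swap₃ {d x y} {d y z} {d z x} tight))

  antipodal⇒median : ∀ {x y z} → perimeter x y z ≡ T → d x y ≡ ½ * T →
                     distSum x y z z ≡ ½ * T
  antipodal⇒median {x} {y} {z} tight dxy≡½T = begin
    (d x z + d y z) + d z z  ≡⟨ cong₂ (λ p q → (p + d y z) + q) (d-sym x z) (d-refl z) ⟩
    (d z x + d y z) + 0ℚ     ≡⟨ +-identityʳ (d z x + d y z) ⟩
    d z x + d y z            ≡⟨ +-comm (d z x) (d y z) ⟩
    d y z + d z x            ≡⟨ half-complement (trans (sym (+-assoc (d x y) (d y z) (d z x))) tight)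
                                                dxy≡½T ⟩
    ½ * T                    ∎
    where open ≡-Reasoning

  diametral⇒median : ∀ {x y z} → perimeter x y z ≡ T → Diametral x y z →
                     ∃[ p ] distSum x y z p ≡ ½ * T
  diametral⇒median tight (inj₁ dxy≡½T) = _ , antipodal⇒median tight dxy≡½T
  diametral⇒median tight (inj₂ (inj₁ dyz≡½T)) =
    _ , distSum-rotate (distSum-rotate (antipodal⇒median (perimeter-rotate tight) dyz≡½T))
  diametral⇒median tight (inj₂ (inj₂ dzx≡½T)) =
    _ , distSum-rotate (antipodal⇒median (perimeter-rotate (perimeter-rotate tight)) dzx≡½T)

  median⇔diametral : ∀ {x y z} → x ≢ y → y ≢ z → z ≢ x → perimeter x y z ≡ T →
                     (∃[ p ] distSum x y z p ≡ ½ * T) ⇔ Diametral x y z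
  median⇔diametral x≢y y≢z z≢x tight =
    mk⇔ (λ (_ , median) → median⇒diametral x≢y y≢z z≢x tight median)
        (diametral⇒median tight)

module WeightedCycle (m : ℕ) (w : Fin (suc m) → ℚ) (w>0 : ∀ e → 0ℚ < w e) where

  open import Data.Rational using (_≤_)
  open RationalArithmetic using (p+q≡r⇒q≡r-p)
  open ℚ-Solver.+-*-Solver using (solve; _:=_; _:+_; _:-_)

  N : ℕ
  N = suc m

  -- The weights unrolled periodically along ℕ, so that arcs never wrap.
  weightℕ : ℕ → ℚ
  weightℕ t = w (t mod N)

  weightℕ-periodic : ∀ t → weightℕ (t ℕ.+ N) ≡ weightℕ t
  weightℕ-periodic t = cong w (Finₚ.fromℕ<-cong _ _ ([m+n]%n≡m%n t N) _ _)

  weightℕ-toℕ : ∀ i → weightℕ (toℕ i) ≡ w i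
  weightℕ-toℕ i = cong w (trans (Finₚ.fromℕ<-cong _ _ (m<n⇒m%n≡m (Finₚ.toℕ<n i)) _ _)
                                (Finₚ.fromℕ<-toℕ i (Finₚ.toℕ<n i)))

  arcℕ : ℕ → ℕ → ℚ
  arcℕ t zero    = 0ℚ
  arcℕ t (suc k) = weightℕ t + arcℕ (suc t) k

  arcℕ-periodic : ∀ t k → arcℕ (t ℕ.+ N) k ≡ arcℕ t k
  arcℕ-periodic t zero    = refl
  arcℕ-periodic t (suc k) = cong₂ _+_ (weightℕ-periodic t) (arcℕ-periodic (suc t) k)

  arcℕ-+ : ∀ t k l → arcℕ t (k ℕ.+ l) ≡ arcℕ t k + arcℕ (t ℕ.+ k) l
  arcℕ-+ t zero l =
    sym (trans (+-identityˡ (arcℕ (t ℕ.+ 0) l))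
               (cong (λ s → arcℕ s l) (ℕₚ.+-identityʳ t)))
  arcℕ-+ t (suc k) l = begin
    weightℕ t + arcℕ (suc t) (k ℕ.+ l)
      ≡⟨ cong (weightℕ t +_) (arcℕ-+ (suc t) k l) ⟩
    weightℕ t + (arcℕ (suc t) k + arcℕ (suc t ℕ.+ k) l)
      ≡⟨ +-assoc (weightℕ t) _ _ ⟨
    arcℕ t (suc k) + arcℕ (suc t ℕ.+ k) l
      ≡⟨ cong (λ s → arcℕ t (suc k) + arcℕ s l) (ℕₚ.+-suc t k) ⟨
    arcℕ t (suc k) + arcℕ (t ℕ.+ suc k) l ∎
    where open ≡-Reasoning

  arcℕ-nonneg : ∀ t k → 0ℚ ≤ arcℕ t k
  arcℕ-nonneg t zero    = ≤-refl
  arcℕ-nonneg t (suc k) = +-mono-≤ (<⇒≤ (w>0 _)) (arcℕ-nonneg (suc t) k)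

  arcℕ-pos : ∀ t {k} → 0 ℕ.< k → 0ℚ < arcℕ t k
  arcℕ-pos t {suc k} _ = +-mono-<-≤ (w>0 _) (arcℕ-nonneg (suc t) k)

  toℕ-next : ∀ (i : Fin N) →
             toℕ (next i) ≡ suc (toℕ i) ⊎ toℕ (next i) ℕ.+ N ≡ suc (toℕ i)
  toℕ-next i with suc (toℕ i) ℕ.<? N
  ... | yes i+1<N = inj₁ (Finₚ.toℕ-fromℕ< i+1<N)
  ... | no i+1≮N  = inj₂ (ℕₚ.≤-antisym (ℕₚ.≮⇒≥ i+1≮N) (Finₚ.toℕ<n i))

  arcℕ-next : ∀ i k → arcℕ (toℕ (next i)) k ≡ arcℕ (suc (toℕ i)) k
  arcℕ-next i k with toℕ-next i
  ... | inj₁ e = cong (λ t → arcℕ t k) e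
  ... | inj₂ e = trans (sym (arcℕ-periodic (toℕ (next i)) k)) (cong (λ t → arcℕ t k) e)

  arc≡arcℕ : ∀ k i → arc w i k ≡ arcℕ (toℕ i) k
  arc≡arcℕ zero    i = refl
  arc≡arcℕ (suc k) i =
    cong₂ _+_ (sym (weightℕ-toℕ i)) (trans (arc≡arcℕ k (next i)) (arcℕ-next i k))

  sum-tabulate : ∀ {k} t (f : Fin k → Fin N) → (∀ s → w (f s) ≡ weightℕ (t ℕ.+ toℕ s)) →
                 foldr _+_ 0ℚ (map w (tabulate f)) ≡ arcℕ t k
  sum-tabulate {zero}  t f w∘f≡ = refl
  sum-tabulate {suc k} t f w∘f≡ =
    cong₂ _+_ (trans (w∘f≡ Fin.zero) (cong weightℕ (ℕₚ.+-identityʳ t)))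
              (sum-tabulate (suc t) (f ∘ Fin.suc) λ s →
                 trans (w∘f≡ (Fin.suc s)) (cong weightℕ (ℕₚ.+-suc t (toℕ s))))

  prefix : ℕ → ℚ
  prefix = arcℕ 0

  prefix-periodic : ∀ t → prefix (N ℕ.+ t) ≡ totalWeight w + prefix t
  prefix-periodic t = trans (arcℕ-+ 0 N t)
    (cong₂ _+_ (sym (sum-tabulate 0 id (sym ∘ weightℕ-toℕ))) (arcℕ-periodic 0 t))

  arc≡prefix-difference : ∀ i k → arc w i k ≡ prefix (toℕ i ℕ.+ k) - prefix (toℕ i)
  arc≡prefix-difference i k = trans (arc≡arcℕ k i) (p+q≡r⇒q≡r-p (sym (arcℕ-+ 0 (toℕ i) k)))

  position : Fin N → ℚ
  position i = prefix (toℕ i)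

  wrap : Fin N → Fin N → ℚ
  wrap i j with toℕ i ℕ.≤? toℕ j
  ... | yes _ = 0ℚ
  ... | no _  = totalWeight w

  forwardLen≡ : ∀ i j → forwardLen w i j ≡ (position j - position i) + wrap i j
  forwardLen≡ i j with toℕ i ℕ.≤? toℕ j
  ... | yes i≤j = begin
    arc w i (toℕ j ℕ.∸ toℕ i)
      ≡⟨ arc≡prefix-difference i _ ⟩
    prefix (toℕ i ℕ.+ (toℕ j ℕ.∸ toℕ i)) - position i
      ≡⟨ cong (λ t → prefix t - position i) (ℕₚ.m+[n∸m]≡n i≤j) ⟩
    position j - position i
      ≡⟨ +-identityʳ _ ⟨
    (position j - position i) + 0ℚ ∎
    where open ≡-Reasoning
  ... | no _ = begin
    arc w i ((N ℕ.∸ toℕ i) ℕ.+ toℕ j)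
      ≡⟨ arc≡prefix-difference i _ ⟩
    prefix (toℕ i ℕ.+ ((N ℕ.∸ toℕ i) ℕ.+ toℕ j)) - position i
      ≡⟨ cong (λ t → prefix t - position i) once-around ⟩
    prefix (N ℕ.+ toℕ j) - position i
      ≡⟨ cong (_- position i) (prefix-periodic (toℕ j)) ⟩
    (totalWeight w + position j) - position i
      ≡⟨ shift (totalWeight w) (position j) (position i) ⟩
    (position j - position i) + totalWeight w ∎
    where
    open ≡-Reasoning
    once-around : toℕ i ℕ.+ ((N ℕ.∸ toℕ i) ℕ.+ toℕ j) ≡ N ℕ.+ toℕ j
    once-around = trans (sym (ℕₚ.+-assoc (toℕ i) _ _))
                        (cong (ℕ._+ toℕ j) (ℕₚ.m+[n∸m]≡n (ℕₚ.<⇒≤ (Finₚ.toℕ<n i))))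
    shift : ∀ t p q → (t + p) - q ≡ (p - q) + t
    shift = solve 3 (λ t p q → (t :+ p) :- q := (p :- q) :+ t) refl

  wrap-concat : ∀ i j k → wrap i j + wrap j k ≡ wrap i k ⊎
                          wrap i j + wrap j k ≡ wrap i k + totalWeight w
  wrap-concat i j k with toℕ i ℕ.≤? toℕ j | toℕ j ℕ.≤? toℕ k | toℕ i ℕ.≤? toℕ k
  ... | yes _   | yes _   | yes _   = inj₁ (+-identityˡ 0ℚ)
  ... | yes i≤j | yes j≤k | no i≰k  = contradiction (ℕₚ.≤-trans i≤j j≤k) i≰k
  ... | yes _   | no _    | yes _   = inj₂ refl
  ... | yes _   | no _    | no _    = inj₁ (+-identityˡ (totalWeight w))
  ... | no _    | yes _   | yes _   = inj₂ (+-comm (totalWeight w) 0ℚ)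
  ... | no _    | yes _   | no _    = inj₁ (+-identityʳ (totalWeight w))
  ... | no i≰j  | no j≰k  | yes i≤k =
    contradiction (ℕₚ.≤-trans i≤k (ℕₚ.<⇒≤ (ℕₚ.≰⇒> j≰k))) i≰j
  ... | no _    | no _    | no _    = inj₂ refl

  forwardLen-concat : ∀ i j k →
    forwardLen w i j + forwardLen w j k ≡ forwardLen w i k ⊎
    forwardLen w i j + forwardLen w j k ≡ forwardLen w i k + totalWeight w
  forwardLen-concat i j k = conclude (wrap-concat i j k)
    where
    δ : ℚ
    δ = position k - position i
    telescope : ∀ p q r s t → ((q - p) + s) + ((r - q) + t) ≡ (r - p) + (s + t)
    telescope = solve 5 (λ p q r s t → ((q :- p) :+ s) :+ ((r :- q) :+ t)
                                      := (r :- p) :+ (s :+ t)) refl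
    telescoped : forwardLen w i j + forwardLen w j k ≡ δ + (wrap i j + wrap j k)
    telescoped = trans (cong₂ _+_ (forwardLen≡ i j) (forwardLen≡ j k))
                       (telescope (position i) (position j) (position k) (wrap i j) (wrap j k))
    conclude : wrap i j + wrap j k ≡ wrap i k ⊎ wrap i j + wrap j k ≡ wrap i k + totalWeight w →
               forwardLen w i j + forwardLen w j k ≡ forwardLen w i k ⊎
               forwardLen w i j + forwardLen w j k ≡ forwardLen w i k + totalWeight w
    conclude (inj₁ e) = inj₁ (trans telescoped (trans (cong (δ +_) e) (sym (forwardLen≡ i k))))
    conclude (inj₂ e) = inj₂ (trans telescoped (trans (cong (δ +_) e)
      (trans (sym (+-assoc δ _ _)) (cong (_+ totalWeight w) (sym (forwardLen≡ i k))))))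

  steps-refl : ∀ (i : Fin N) → steps i i ≡ 0
  steps-refl i with toℕ i ℕ.≤? toℕ i
  ... | yes _  = ℕₚ.n∸n≡0 (toℕ i)
  ... | no i≰i = contradiction ℕₚ.≤-refl i≰i

  steps-pos : ∀ {i j : Fin N} → i ≢ j → 0 ℕ.< steps i j
  steps-pos {i} {j} i≢j with toℕ i ℕ.≤? toℕ j
  ... | yes i≤j = ℕₚ.m<n⇒0<n∸m (ℕₚ.≤∧≢⇒< i≤j (i≢j ∘ Finₚ.toℕ-injective))
  ... | no _    = ℕₚ.<-≤-trans (ℕₚ.m<n⇒0<n∸m (Finₚ.toℕ<n i)) (ℕₚ.m≤m+n _ _)

  forwardLen-refl : ∀ i → forwardLen w i i ≡ 0ℚ
  forwardLen-refl i = cong (arc w i) (steps-refl i)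

  forwardLen-pos : ∀ {i j} → i ≢ j → 0ℚ < forwardLen w i j
  forwardLen-pos {i} {j} i≢j =
    subst (0ℚ <_) (sym (arc≡arcℕ (steps i j) i)) (arcℕ-pos (toℕ i) (steps-pos i≢j))

-- ℚ's _≤_ is opened only inside the modules above, so that 3 ≤ n below is ℕ's.
open import Data.Nat using (_≤_)

lemma2p6 : (n : ℕ) → 3 ≤ n → (w : Fin n → ℚ) → (∀ e → 0ℚ < w e) →
           (x y z : Fin n) → x ≢ y → y ≢ z → z ≢ x →
           dist w x y + dist w y z + dist w z x ≡ totalWeight w →
           (∃[ p ] (dist w x p + dist w y p + dist w z p
                      ≡ ½ * (dist w x y + dist w y z + dist w z x)))
           ⇔ ((dist w x y ⊔ dist w y z) ⊔ dist w z x ≡ ½ * totalWeight w)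
lemma2p6 (suc m) _ w w>0 x y z x≢y y≢z z≢x tight rewrite tight =
  ⊔₃≡⇔ (d≤half x≢y) (d≤half y≢z) (d≤half z≢x) ⇔-∘ median⇔diametral x≢y y≢z z≢x tight
  where
  open RationalArithmetic using (⊔₃≡⇔)
  open WeightedCycle m w w>0
  open Circle Finₚ._≟_ (totalWeight w) (forwardLen w)
              forwardLen-refl forwardLen-pos forwardLen-concat
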